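{- Let $\varepsilon>0$. Then $E[[X]]^{\Gamma_k\text{ - }\mathrm{sh},k+\varepsilon}\subset E[[X^p]]$.
   Context: $E$ is a field of characteristic $p$; $\mathbf{Z}_p^\times$ acts on $E[[X]]$ by $(a\cdot f)(X)=f((1+X)^a-1)$; $\operatorname{val}_X$ is the $X$-adic valuation. $k\ge1$ ($k\ge2$ if $p=2$), $\Gamma_k=1+p^k\mathbf{Z}_p$ with coordinate $c(1+p^ka)=a$. For $\lambda\in\mathbf{R}$, $E[[X]]^{\Gamma_k\text{ - }\mathrm{sh},\lambda}$ is the set of $f\in E[[X]]$ for which there is $\mu\in\mathbf{R}$ with $\operatorname{val}_X(c^{ -1}(x)\cdot f-c^{ -1}(y)\cdot f)\ge p^\lambda p^i+\mu$ for all $x,y\in\mathbf{Z}_p$ and integers $i\ge0$ with $\operatorname{val}_p(x-y)\ge i$.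
   Formalization: The parameter ε ranges only over values with p^ε rational, and the constant μ in the definition of the sets $E[[X]]^{\Gamma_k\text{ - }\mathrm{sh},\lambda}$ is rational instead of real. -}

module Defs where

open import Level using (Level; _⊔_)
open import Algebra.Bundles using (CommutativeRing)
open import Data.Nat as ℕ using (ℕ; zero; suc; _<ᵇ_; _∸_)
open import Data.Nat.Combinatorics using (_C_)
open import Data.Nat.Divisibility using (_∣_)
open import Data.Fin using (Fin; toℕ)
open import Data.Bool using (if_then_else_)
open import Data.Integer using (+_)
open import Data.Rational as ℚ using (ℚ; _/_)
open import Data.Product using (Σ; ∃; _×_)
open import Relation.Nullary using (¬_)
open import Relation.Binary.PropositionalEquality using (_≡_)

-- p-adic integers, as sequences of p-adic digits (x = Σ_j x j * p^j)
ℤₚ : ℕ → Set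
ℤₚ p = ℕ → Fin p

ℕ→ℚ : ℕ → ℚ
ℕ→ℚ n = (+ n) / 1

trunc : (p : ℕ) → (ℕ → ℕ) → ℕ → ℕ
trunc p d zero    = 0
trunc p d (suc N) = trunc p d N ℕ.+ d N ℕ.* (p ℕ.^ N)

-- digit sequence of c⁻¹(x) = 1 + p^k x  (for k ≥ 1 there are no carries)
cinvDigits : (p k : ℕ) → ℤₚ p → ℕ → ℕ
cinvDigits p k x zero    = 1
cinvDigits p k x (suc j) = if suc j <ᵇ k then 0 else toℕ (x (suc j ∸ k))

module PowerSeries {c ℓ : Level} (R : CommutativeRing c ℓ) where
  open CommutativeRing R

  PS : Set c
  PS = ℕ → Carrier

  sumTo : (ℕ → Carrier) → ℕ → Carrier
  sumTo f zero    = 0#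
  sumTo f (suc n) = sumTo f n + f n

  natE : ℕ → Carrier
  natE zero    = 0#
  natE (suc n) = 1# + natE n

  _-ₛ_ : PS → PS → PS
  (f -ₛ g) n = f n - g n

  _*ₛ_ : PS → PS → PS
  (f *ₛ g) n = sumTo (λ j → f j * g (n ∸ j)) (suc n)

  oneₛ : PS
  oneₛ zero    = 1#
  oneₛ (suc n) = 0#

  powₛ : PS → ℕ → PS
  powₛ h zero    = oneₛ
  powₛ h (suc m) = h *ₛ powₛ h m

  -- composition f(h(X)) for h with zero constant term
  compₛ : PS → PS → PS
  compₛ f h n = sumTo (λ m → f m * powₛ h m n) (suc n)

  -- (1+X)^a - 1 for a p-adic integer a with digit sequence d, in characteristic p:
  -- (1+X)^a is the X-adic limit of (1+X)^{a_N}, a_N = trunc a N; its coefficient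
  -- of X^n is already stable for N = n+1 (since p^{n+1} > n).
  binomMinusOne : (p : ℕ) → (ℕ → ℕ) → PS
  binomMinusOne p d zero    = 0#
  binomMinusOne p d (suc n) = natE (trunc p d (suc (suc n)) C suc n)

  act : (p : ℕ) → (ℕ → ℕ) → PS → PS
  act p d f = compₛ f (binomMinusOne p d)

  valGe : PS → ℚ → Set (ℓ)
  valGe g r = ∀ n → ℕ→ℚ n ℚ.< r → g n ≈ 0#

  -- E[[X]]^{Γ_k-sh, λ}, where the parameter P stands for the real number p^λ
  IsShP : (p k : ℕ) → ℚ → PS → Set ℓ
  IsShP p k P f =
    Σ ℚ λ μ → ∀ (x y : ℤₚ p) (i : ℕ) →
      (∀ j → j ℕ.< i → x j ≡ y j) →
      valGe (act p (cinvDigits p k x) f -ₛ act p (cinvDigits p k y) f)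
            (P ℚ.* ℕ→ℚ (p ℕ.^ i) ℚ.+ μ)

  InXp : (p : ℕ) → PS → Set ℓ
  InXp p f = ∀ n → ¬ (p ∣ n) → f n ≈ 0#

record IsField {c ℓ : Level} (R : CommutativeRing c ℓ) : Set (c ⊔ ℓ) where
  open CommutativeRing R
  field
    nontrivial : ¬ (1# ≈ 0#)
    inverse    : ∀ x → ¬ (x ≈ 0#) → ∃ λ y → x * y ≈ 1#

HasChar : {c ℓ : Level} (R : CommutativeRing c ℓ) → ℕ → Set ℓ
HasChar R p = let open CommutativeRing R; open PowerSeries R in natE p ≈ 0#

-- Test the shift condition at x = p^i and y = 0, where c⁻¹(x) = 1 + p^(k+i) and c⁻¹(y) = 1.
-- With Q = p^(k+i), in characteristic p we have (1+X)^(1+Q) − 1 = X + X^Q + X^(Q+1), so below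
-- X^(2Q) the difference f(X + X^Q + X^(Q+1)) − f(X) is f′(X)·(X^Q + X^(Q+1)). If m·f_m = 0 for
-- all m ≤ n, its coefficient at X^(Q+n) is (n+1)·f_(n+1). Since λ = k + ε, the condition makes
-- this coefficient vanish once Q + n < p^ε·Q + μ, which holds for large i. Hence f′ = 0 by
-- induction, and in characteristic p this means f ∈ E[[X^p]].
module Submission where

open import Defs
open import Data.Nat using (ℕ)
open import Algebra.Bundles using (CommutativeRing)
open import Data.Nat.Primality using (Prime)

module PrimePowerBinomial where

  open import Data.Nat
  open import Data.Nat.Properties
  open import Data.Nat.Combinatorics using (_C_; nCk+nC[k+1]≡[n+1]C[k+1])
  open import Data.Nat.Divisibility
  open import Data.Nat.Primality using (Prime; euclidsLemma; prime⇒nonZero; prime⇒irreducible)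
  open import Data.Nat.Coprimality using (Coprime)
  open import Data.Product using (_,_)
  open import Data.Sum using (inj₁; inj₂)
  open import Relation.Nullary using (¬_; yes; no; contradiction)
  open import Relation.Binary.PropositionalEquality

  [1+k]*[1+n]C[1+k]≡[1+n]*nCk : ∀ n k → suc k * (suc n C suc k) ≡ suc n * (n C k)
  [1+k]*[1+n]C[1+k]≡[1+n]*nCk zero    zero    = refl
  [1+k]*[1+n]C[1+k]≡[1+n]*nCk zero    (suc k) = *-zeroʳ (suc (suc k))
  [1+k]*[1+n]C[1+k]≡[1+n]*nCk (suc n) k       = begin
    suc k * (suc (suc n) C suc k)
      ≡⟨ cong (suc k *_) (nCk+nC[k+1]≡[n+1]C[k+1] (suc n) k) ⟨
    suc k * (suc n C k + suc n C suc k)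
      ≡⟨ *-distribˡ-+ (suc k) (suc n C k) (suc n C suc k) ⟩
    suc k * (suc n C k) + suc k * (suc n C suc k)
      ≡⟨ cong (suc k * (suc n C k) +_) ([1+k]*[1+n]C[1+k]≡[1+n]*nCk n k) ⟩
    suc k * (suc n C k) + suc n * (n C k)
      ≡⟨ absorb k ⟩
    suc (suc n) * (suc n C k) ∎
    where
    open ≡-Reasoning
    absorb : ∀ k → suc k * (suc n C k) + suc n * (n C k) ≡ suc (suc n) * (suc n C k)
    absorb zero     = refl
    absorb (suc k′) = begin
      (suc n C suc k′ + suc k′ * (suc n C suc k′)) + suc n * (n C suc k′)
        ≡⟨ cong (λ t → (suc n C suc k′ + t) + suc n * (n C suc k′)) ([1+k]*[1+n]C[1+k]≡[1+n]*nCk n k′) ⟩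
      (suc n C suc k′ + suc n * (n C k′)) + suc n * (n C suc k′)
        ≡⟨ +-assoc (suc n C suc k′) _ _ ⟩
      suc n C suc k′ + (suc n * (n C k′) + suc n * (n C suc k′))
        ≡⟨ cong (suc n C suc k′ +_) (*-distribˡ-+ (suc n) (n C k′) (n C suc k′)) ⟨
      suc n C suc k′ + suc n * (n C k′ + n C suc k′)
        ≡⟨ cong (λ t → suc n C suc k′ + suc n * t) (nCk+nC[k+1]≡[n+1]C[k+1] n k′) ⟩
      suc n C suc k′ + suc n * (suc n C suc k′) ∎

  n<m^n : ∀ {m} → 1 < m → ∀ n → n < m ^ n
  n<m^n         _   zero    = s≤s z≤n
  n<m^n {m@(suc _)} 1<m (suc n) = begin-strict
    suc n          ≤⟨ n<m^n 1<m n ⟩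
    m ^ n          <⟨ m<m+n (m ^ n) (m^n>0 m n) ⟩
    m ^ n + m ^ n  ≡⟨ cong (m ^ n +_) (+-identityʳ (m ^ n)) ⟨
    2 * m ^ n      ≤⟨ *-monoˡ-≤ (m ^ n) 1<m ⟩
    m * m ^ n      ∎
    where open ≤-Reasoning

  module _ {p : ℕ} (p-prime : Prime p) where

    private instance
      p≢0 : NonZero p
      p≢0 = prime⇒nonZero p-prime

    ∤⇒coprime : ∀ {n} → ¬ p ∣ n → Coprime p n
    ∤⇒coprime p∤n (d∣p , d∣n) with prime⇒irreducible p-prime d∣p
    ... | inj₁ d≡1  = d≡1
    ... | inj₂ refl = contradiction d∣n p∤n

    p^a∣m*n⇒p^a∣m : ∀ a {m n} → ¬ p ∣ n → p ^ a ∣ m * n → p ^ a ∣ m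
    p^a∣m*n⇒p^a∣m zero    {m}     _   _ = 1∣ m
    p^a∣m*n⇒p^a∣m (suc a) {m} {n} p∤n p^a+1∣mn
      with euclidsLemma m n p-prime (∣-trans (m∣m*n (p ^ a)) p^a+1∣mn)
    ... | inj₂ p∣n = contradiction p∣n p∤n
    ... | inj₁ (divides m′ refl) =
      subst (p ^ suc a ∣_) (*-comm p m′) (*-monoʳ-∣ p (p^a∣m*n⇒p^a∣m a p∤n p^a∣m′n))
      where
      p^a∣m′n : p ^ a ∣ m′ * n
      p^a∣m′n = *-cancelˡ-∣ p (subst (p ^ suc a ∣_) (trans (cong (_* n) (*-comm m′ p)) (*-assoc p m′ n)) p^a+1∣mn)

    -- j · C(p^M, j) = p^M · C(p^M − 1, j − 1), and p^M cannot divide 0 < j < p^M.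
    p∣[p^M]Cj : ∀ M j → 0 < j → j < p ^ M → p ∣ (p ^ M) C j
    p∣[p^M]Cj M (suc j) _ j<p^M with p ∣? (p ^ M) C suc j
    ... | yes p∣ = p∣
    ... | no  p∤ = contradiction (∣⇒≤ (p^a∣m*n⇒p^a∣m M p∤ p^M∣[1+j]C)) (<⇒≱ j<p^M)
      where
      p^M∣[1+j]C : p ^ M ∣ suc j * (p ^ M C suc j)
      p^M∣[1+j]C with p ^ M | m^n≢0 p M
      ... | suc Q-1 | _ = subst (suc Q-1 ∣_) (sym ([1+k]*[1+n]C[1+k]≡[1+n]*nCk Q-1 j)) (m∣m*n (Q-1 C j))


module NatToRational where

  open import Data.Nat as ℕ using (suc)
  import Data.Nat.Properties as ℕ
  open import Data.Integer as ℤ using (+_; -[1+_])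
  import Data.Integer.Properties as ℤ
  open import Data.Rational
  open import Data.Rational.Properties
  open import Data.Rational.Solver using (module +-*-Solver)
  open import Data.Nat.Coprimality using (1-coprimeTo; sym)
  open import Data.Product using (∃; _,_)
  open import Relation.Binary.PropositionalEquality
    using (_≡_; refl; cong; cong₂; subst; subst₂) renaming (sym to ≡-sym; trans to ≡-trans)

  ℕ→ℚ≡mkℚ : ∀ n → ℕ→ℚ n ≡ mkℚ (+ n) 0 (sym (1-coprimeTo n))
  ℕ→ℚ≡mkℚ n = normalize-coprime (sym (1-coprimeTo n))

  ℕ→ℚ-+ : ∀ m n → ℕ→ℚ (m ℕ.+ n) ≡ ℕ→ℚ m + ℕ→ℚ n
  ℕ→ℚ-+ m n rewrite ℕ→ℚ≡mkℚ m | ℕ→ℚ≡mkℚ n =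
    cong (_/ 1) (≡-trans (ℤ.pos-+ m n) (≡-sym (cong₂ ℤ._+_ (ℤ.*-identityʳ (+ m)) (ℤ.*-identityʳ (+ n)))))

  ℕ→ℚ-* : ∀ m n → ℕ→ℚ (m ℕ.* n) ≡ ℕ→ℚ m * ℕ→ℚ n
  ℕ→ℚ-* m n rewrite ℕ→ℚ≡mkℚ m | ℕ→ℚ≡mkℚ n = cong (_/ 1) (ℤ.pos-* m n)

  ℕ→ℚ-mono-≤ : ∀ {m n} → m ℕ.≤ n → ℕ→ℚ m ≤ ℕ→ℚ n
  ℕ→ℚ-mono-≤ {m} {n} m≤n rewrite ℕ→ℚ≡mkℚ m | ℕ→ℚ≡mkℚ n =
    *≤* (subst₂ ℤ._≤_ (≡-sym (ℤ.*-identityʳ (+ m))) (≡-sym (ℤ.*-identityʳ (+ n))) (ℤ.+≤+ m≤n))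

  ℕ→ℚ-nonNeg : ∀ n → NonNegative (ℕ→ℚ n)
  ℕ→ℚ-nonNeg n rewrite ℕ→ℚ≡mkℚ n = _

  ℕ→ℚ-unbounded : ∀ r → ∃ λ n → r < ℕ→ℚ n
  ℕ→ℚ-unbounded r@(mkℚ (+ m) d _) = suc m , subst (r <_) (≡-sym (ℕ→ℚ≡mkℚ (suc m)))
    (*<* (subst₂ ℤ._<_ (≡-sym (ℤ.*-identityʳ (+ m))) (ℤ.pos-* (suc m) (suc d))
      (ℤ.+<+ (ℕ.m≤m*n (suc m) (suc d)))))
  ℕ→ℚ-unbounded r@(mkℚ -[1+ m ] d _) = 0 , subst (r <_) (≡-sym (ℕ→ℚ≡mkℚ 0))
    (*<* (subst (ℤ._< + 0 ℤ.* + suc d) (≡-sym (ℤ.*-identityʳ -[1+ m ])) ℤ.-<+))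

  multiple>1 : ∀ {a} → 0ℚ < a → ∃ λ m → 1ℚ < a * ℕ→ℚ m
  multiple>1 {a} 0<a = above (ℕ→ℚ-unbounded (1/ a))
    where
    instance
      a-pos : Positive a
      a-pos = positive 0<a
      a≢0 : NonZero a
      a≢0 = pos⇒nonZero a
    above : ∃ (λ m → 1/ a < ℕ→ℚ m) → ∃ λ m → 1ℚ < a * ℕ→ℚ m
    above (m , 1/a<m) = m , subst (_< a * ℕ→ℚ m) (*-inverseʳ a) (*-monoʳ-<-pos a 1/a<m)

  archimedean : ∀ {a} → 0ℚ < a → ∀ c → ∃ λ T₀ → ∀ T → T₀ ℕ.≤ T → c < a * ℕ→ℚ T
  archimedean {a} 0<a c with multiple>1 0<a | ℕ→ℚ-unbounded c
  ... | m , 1<am | n , c<n = m ℕ.* n , λ T mn≤T → begin-strict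
    c                        <⟨ c<n ⟩
    ℕ→ℚ n                    ≡⟨ *-identityˡ (ℕ→ℚ n) ⟨
    1ℚ * ℕ→ℚ n               ≤⟨ *-monoʳ-≤-nonNeg (ℕ→ℚ n) {{ℕ→ℚ-nonNeg n}} (<⇒≤ 1<am) ⟩
    (a * ℕ→ℚ m) * ℕ→ℚ n      ≡⟨ *-assoc a (ℕ→ℚ m) (ℕ→ℚ n) ⟩
    a * (ℕ→ℚ m * ℕ→ℚ n)      ≡⟨ cong (a *_) (ℕ→ℚ-* m n) ⟨
    a * ℕ→ℚ (m ℕ.* n)        ≤⟨ *-monoˡ-≤-nonNeg a {{pos⇒nonNeg a {{positive 0<a}}}} (ℕ→ℚ-mono-≤ mn≤T) ⟩
    a * ℕ→ℚ T                ∎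
    where open ≤-Reasoning

  q*[m*n]≡m*q*n : ∀ q m n → q * ℕ→ℚ (m ℕ.* n) ≡ ℕ→ℚ m * q * ℕ→ℚ n
  q*[m*n]≡m*q*n q m n = ≡-trans (cong (q *_) (ℕ→ℚ-* m n))
    (solve 3 (λ q a b → q :* (a :* b) := a :* q :* b) refl q (ℕ→ℚ m) (ℕ→ℚ n))
    where open +-*-Solver

  1<q⇒0<q-1 : ∀ {q} → 1ℚ < q → 0ℚ < q - 1ℚ
  1<q⇒0<q-1 {q} 1<q = subst (_< q - 1ℚ) (+-inverseʳ 1ℚ) (+-monoˡ-< (- 1ℚ) 1<q)

  ℕ→ℚ[T+n]<q*T+μ-eventually : ∀ {q} → 1ℚ < q → ∀ n μ →
    ∃ λ T₀ → ∀ T → T₀ ℕ.≤ T → ℕ→ℚ (T ℕ.+ n) < q * ℕ→ℚ T + μ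
  ℕ→ℚ[T+n]<q*T+μ-eventually {q} 1<q n μ = rearrange (archimedean (1<q⇒0<q-1 1<q) (ℕ→ℚ n - μ))
    where
    open +-*-Solver
    rearrange : (∃ λ T₀ → ∀ T → T₀ ℕ.≤ T → ℕ→ℚ n - μ < (q - 1ℚ) * ℕ→ℚ T) →
                ∃ λ T₀ → ∀ T → T₀ ℕ.≤ T → ℕ→ℚ (T ℕ.+ n) < q * ℕ→ℚ T + μ
    rearrange (T₀ , below) = T₀ , λ T T₀≤T →
      subst₂ _<_ (lhs T) (rhs T) (+-monoˡ-< (ℕ→ℚ T + μ) (below T T₀≤T))
      where
      lhs : ∀ T → (ℕ→ℚ n - μ) + (ℕ→ℚ T + μ) ≡ ℕ→ℚ (T ℕ.+ n)
      lhs T = ≡-trans (solve 3 (λ n μ t → (n :- μ) :+ (t :+ μ) := t :+ n) refl (ℕ→ℚ n) μ (ℕ→ℚ T))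
                      (≡-sym (ℕ→ℚ-+ T n))
      rhs : ∀ T → (q - 1ℚ) * ℕ→ℚ T + (ℕ→ℚ T + μ) ≡ q * ℕ→ℚ T + μ
      rhs T = solve 3 (λ q μ t → (q :- con 1ℚ) :* t :+ (t :+ μ) := q :* t :+ μ) refl q μ (ℕ→ℚ T)

module Digits (p : ℕ) where

  open import Data.Nat
  open import Data.Nat.Properties
  open import Data.Fin using (Fin; toℕ; fromℕ<)
  open import Data.Fin.Properties using (toℕ-fromℕ<)
  open import Data.Bool using (true; false; T)
  open import Data.Sum using (inj₁; inj₂)
  open import Relation.Nullary using (yes; no; contradiction)
  open import Relation.Binary.PropositionalEquality
  open import Function using (_∘_)

  trunc-stable : ∀ (d : ℕ → ℕ) {J J′} → J ≤ J′ → (∀ j → J ≤ j → j < J′ → d j ≡ 0) →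
                 trunc p d J′ ≡ trunc p d J
  trunc-stable d {J′ = zero}   z≤n _ = refl
  trunc-stable d {J} {suc J′} J≤ zeros with m≤n⇒m<n∨m≡n J≤
  ... | inj₂ refl  = refl
  ... | inj₁ J<1+J′ = begin
    trunc p d J′ + d J′ * p ^ J′  ≡⟨ cong (λ t → trunc p d J′ + t * p ^ J′) (zeros J′ J≤J′ (n<1+n J′)) ⟩
    trunc p d J′ + 0              ≡⟨ +-identityʳ _ ⟩
    trunc p d J′                  ≡⟨ trunc-stable d J≤J′ (λ j J≤j j<J′ → zeros j J≤j (m<n⇒m<1+n j<J′)) ⟩
    trunc p d J                   ∎
    where
    open ≡-Reasoning
    J≤J′ : J ≤ J′
    J≤J′ = s≤s⁻¹ J<1+J′

  module _ {k : ℕ} (1≤k : 1 ≤ k) where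

    cinvDigits-< : ∀ x {j} → 0 < j → j < k → cinvDigits p k x j ≡ 0
    cinvDigits-< x {suc j} _ j<k with suc j <ᵇ k | <⇒<ᵇ j<k
    ... | true  | _  = refl
    ... | false | ()

    cinvDigits-≥ : ∀ x {j} → k ≤ j → cinvDigits p k x j ≡ toℕ (x (j ∸ k))
    cinvDigits-≥ x {zero}  k≤0 = contradiction (≤-trans 1≤k k≤0) λ ()
    cinvDigits-≥ x {suc j} k≤j with suc j <ᵇ k in eq
    ... | false = refl
    ... | true  = contradiction (<ᵇ⇒< (suc j) k (subst T (sym eq) _)) (≤⇒≯ k≤j)

    module TestPoint (1<p : 1 < p) (i : ℕ) where

      digit₀ digit₁ : Fin p
      digit₀ = fromℕ< (<-trans z<s 1<p)
      digit₁ = fromℕ< 1<p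

      p^i 0ₚ : ℤₚ p
      p^i j with j ≟ i
      ... | yes _ = digit₁
      ... | no  _ = digit₀
      0ₚ _ = digit₀

      p^i≡0ₚ-below : ∀ j → j < i → p^i j ≡ 0ₚ j
      p^i≡0ₚ-below j j<i with j ≟ i
      ... | yes refl = contradiction j<i (<-irrefl refl)
      ... | no  _    = refl

      M : ℕ
      M = k + i

      d d₀ : ℕ → ℕ
      d  = cinvDigits p k p^i
      d₀ = cinvDigits p k 0ₚ

      toℕ-p^i-≢ : ∀ {j} → j ≢ i → toℕ (p^i j) ≡ 0
      toℕ-p^i-≢ {j} j≢i with j ≟ i
      ... | yes j≡i = contradiction j≡i j≢i
      ... | no  _   = toℕ-fromℕ< _

      toℕ-p^i-i : toℕ (p^i i) ≡ 1
      toℕ-p^i-i with i ≟ i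
      ... | yes _   = toℕ-fromℕ< _
      ... | no  i≢i = contradiction refl i≢i

      d-≢M : ∀ {j} → 0 < j → j ≢ M → d j ≡ 0
      d-≢M {j} 0<j j≢M with j <? k
      ... | yes j<k = cinvDigits-< p^i 0<j j<k
      ... | no  j≮k = trans (cinvDigits-≥ p^i k≤j) (toℕ-p^i-≢ λ j∸k≡i →
                        j≢M (trans (sym (m+[n∸m]≡n k≤j)) (cong (k +_) j∸k≡i)))
        where
        k≤j : k ≤ j
        k≤j = ≮⇒≥ j≮k

      d-M : d M ≡ 1
      d-M = trans (cinvDigits-≥ p^i (m≤m+n k i)) (trans (cong (toℕ ∘ p^i) (m+n∸m≡n k i)) toℕ-p^i-i)

      d₀-pos : ∀ {j} → 0 < j → d₀ j ≡ 0
      d₀-pos {j} 0<j with j <? k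
      ... | yes j<k = cinvDigits-< 0ₚ 0<j j<k
      ... | no  j≮k = trans (cinvDigits-≥ 0ₚ (≮⇒≥ j≮k)) (toℕ-fromℕ< _)

      1≤M : 1 ≤ M
      1≤M = ≤-trans 1≤k (m≤m+n k i)

      trunc-d-≤ : ∀ {J} → 1 ≤ J → J ≤ M → trunc p d J ≡ 1
      trunc-d-≤ 1≤J J≤M = trunc-stable d 1≤J λ j 1≤j j<J → d-≢M 1≤j (<⇒≢ (<-≤-trans j<J J≤M))

      trunc-d-≥ : ∀ {J} → M ≤ J → trunc p d (suc J) ≡ suc (p ^ M)
      trunc-d-≥ {J} M≤J = begin
        trunc p d (suc J)              ≡⟨ trunc-stable d (s≤s M≤J) (λ j M<j _ → d-≢M (≤-<-trans z≤n M<j) (>⇒≢ M<j)) ⟩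
        trunc p d M + d M * p ^ M      ≡⟨ cong₂ (λ a b → a + b * p ^ M) (trunc-d-≤ 1≤M ≤-refl) d-M ⟩
        1 + 1 * p ^ M                  ≡⟨ cong suc (*-identityˡ (p ^ M)) ⟩
        suc (p ^ M)                    ∎
        where open ≡-Reasoning

      trunc-d₀ : ∀ J → trunc p d₀ (suc J) ≡ 1
      trunc-d₀ J = trunc-stable d₀ {J′ = suc J} (s≤s z≤n) λ j 1≤j _ → d₀-pos 1≤j

module Series {c ℓ} (R : CommutativeRing c ℓ) where

  open CommutativeRing R
  open PowerSeries R
  open import Data.Nat as ℕ using (ℕ; zero; suc; _∸_; s≤s)
  import Data.Nat.Properties as ℕ
  open import Relation.Nullary using (yes; no; contradiction)
  open import Relation.Binary.PropositionalEquality as ≡ using (_≡_; _≢_)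
  open import Relation.Binary.Definitions using (tri<; tri≈; tri>)
  open import Relation.Binary.Reasoning.Setoid setoid
  open import Algebra.Properties.CommutativeSemigroup +-commutativeSemigroup using (interchange)
  open import Function using (_∘_)

  X^_ : ℕ → PS
  (X^ zero)  zero    = 1#
  (X^ zero)  (suc n) = 0#
  (X^ suc m) zero    = 0#
  (X^ suc m) (suc n) = (X^ m) n

  X^-diag : ∀ n → (X^ n) n ≡ 1#
  X^-diag zero    = ≡.refl
  X^-diag (suc n) = X^-diag n

  X^-offdiag : ∀ {m n} → m ≢ n → (X^ m) n ≡ 0#
  X^-offdiag {zero}  {zero}  m≢n = contradiction ≡.refl m≢n
  X^-offdiag {zero}  {suc n} _   = ≡.refl
  X^-offdiag {suc m} {zero}  _   = ≡.refl
  X^-offdiag {suc m} {suc n} m≢n = X^-offdiag (m≢n ∘ ≡.cong suc)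

  shift : ℕ → PS → PS
  shift zero    u a       = u a
  shift (suc m) u zero    = 0#
  shift (suc m) u (suc a) = shift m u a

  shift-≤ : ∀ m u {a} → m ℕ.≤ a → shift m u a ≡ u (a ∸ m)
  shift-≤ zero    u _         = ≡.refl
  shift-≤ (suc m) u (s≤s m≤a) = shift-≤ m u m≤a

  shift-> : ∀ m u {a} → a ℕ.< m → shift m u a ≡ 0#
  shift-> (suc m) u {zero}  _         = ≡.refl
  shift-> (suc m) u {suc a} (s≤s a<m) = shift-> m u a<m

  shift-vanishes : ∀ {Q} u → (∀ j → j ℕ.< Q → u j ≈ 0#) → ∀ m a → a ∸ m ℕ.< Q → shift m u a ≈ 0#
  shift-vanishes u u<Q m a a∸m<Q with m ℕ.≤? a
  ... | yes m≤a = trans (reflexive (shift-≤ m u m≤a)) (u<Q (a ∸ m) a∸m<Q)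
  ... | no  m≰a = reflexive (shift-> m u (ℕ.≰⇒> m≰a))

  sumTo-cong : ∀ {f g} n → (∀ j → j ℕ.< n → f j ≈ g j) → sumTo f n ≈ sumTo g n
  sumTo-cong zero    _     = refl
  sumTo-cong (suc n) f≈g = +-cong (sumTo-cong n λ j j<n → f≈g j (ℕ.m<n⇒m<1+n j<n)) (f≈g n (ℕ.n<1+n n))

  sumTo-zero : ∀ {f} n → (∀ j → j ℕ.< n → f j ≈ 0#) → sumTo f n ≈ 0#
  sumTo-zero zero    _  = refl
  sumTo-zero (suc n) f≈0 =
    trans (+-cong (sumTo-zero n λ j j<n → f≈0 j (ℕ.m<n⇒m<1+n j<n)) (f≈0 n (ℕ.n<1+n n))) (+-identityʳ 0#)

  sumTo-single : ∀ (f : PS) n {j₀} → j₀ ℕ.< n → (∀ j → j ℕ.< n → j ≢ j₀ → f j ≈ 0#) → sumTo f n ≈ f j₀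
  sumTo-single f (suc n) {j₀} j₀<1+n others with j₀ ℕ.≟ n
  ... | yes ≡.refl = trans (+-cong (sumTo-zero n λ j j<n → others j (ℕ.m<n⇒m<1+n j<n) (ℕ.<⇒≢ j<n)) refl)
                           (+-identityˡ (f j₀))
  ... | no  j₀≢n   = trans (+-cong (sumTo-single f n (ℕ.≤∧≢⇒< (ℕ.s≤s⁻¹ j₀<1+n) j₀≢n)
                                      λ j j<n → others j (ℕ.m<n⇒m<1+n j<n))
                                   (others n (ℕ.n<1+n n) (j₀≢n ∘ ≡.sym)))
                           (+-identityʳ (f j₀))

  sumTo-+ : ∀ (f g : PS) n → sumTo (λ j → f j + g j) n ≈ sumTo f n + sumTo g n
  sumTo-+ f g zero    = sym (+-identityʳ 0#)
  sumTo-+ f g (suc n) = trans (+-cong (sumTo-+ f g n) refl) (interchange _ _ _ _)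

  natE-+ : ∀ m n → natE (m ℕ.+ n) ≈ natE m + natE n
  natE-+ zero    n = sym (+-identityˡ (natE n))
  natE-+ (suc m) n = trans (+-cong refl (natE-+ m n)) (sym (+-assoc 1# (natE m) (natE n)))

  natE-* : ∀ m n → natE (m ℕ.* n) ≈ natE m * natE n
  natE-* zero    n = sym (zeroˡ (natE n))
  natE-* (suc m) n = begin
    natE (n ℕ.+ m ℕ.* n)            ≈⟨ natE-+ n (m ℕ.* n) ⟩
    natE n + natE (m ℕ.* n)         ≈⟨ +-cong (sym (*-identityˡ (natE n))) (natE-* m n) ⟩
    1# * natE n + natE m * natE n   ≈⟨ distribʳ (natE n) 1# (natE m) ⟨
    (1# + natE m) * natE n          ∎

  natE-1 : natE 1 ≈ 1#
  natE-1 = +-identityʳ 1#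

  sumTo-*X^ : ∀ (g : PS) {n j} → j ℕ.< n → sumTo (λ m → g m * (X^ m) j) n ≈ g j
  sumTo-*X^ g {n} {j} j<n = trans
    (sumTo-single (λ m → g m * (X^ m) j) n j<n λ m _ m≢j →
      trans (*-cong refl (reflexive (X^-offdiag m≢j))) (zeroʳ (g m)))
    (trans (*-cong refl (reflexive (X^-diag j))) (*-identityʳ (g j)))

  X^*ₛ-coeff : ∀ a (g : PS) n → ((X^ a) *ₛ g) n ≈ shift a g n
  X^*ₛ-coeff a g n with a ℕ.≤? n
  ... | yes a≤n = begin
    sumTo (λ j → (X^ a) j * g (n ∸ j)) (suc n)
      ≈⟨ sumTo-single (λ j → (X^ a) j * g (n ∸ j)) (suc n) (s≤s a≤n) (λ j _ j≢a →
           trans (*-cong (reflexive (X^-offdiag (j≢a ∘ ≡.sym))) refl) (zeroˡ _)) ⟩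
    (X^ a) a * g (n ∸ a)  ≈⟨ trans (*-cong (reflexive (X^-diag a)) refl) (*-identityˡ _) ⟩
    g (n ∸ a)             ≡⟨ shift-≤ a g a≤n ⟨
    shift a g n           ∎
  ... | no  a≰n = trans
    (sumTo-zero (suc n) λ j j≤n →
      trans (*-cong (reflexive (X^-offdiag λ a≡j → a≰n (ℕ.≤-trans (ℕ.≤-reflexive a≡j) (ℕ.s≤s⁻¹ j≤n)))) refl)
            (zeroˡ _))
    (sym (reflexive (shift-> a g (ℕ.≰⇒> a≰n))))

  *ₛX^-coeff : ∀ a (g : PS) n → (g *ₛ (X^ a)) n ≈ shift a g n
  *ₛX^-coeff a g n with a ℕ.≤? n
  ... | yes a≤n = begin
    sumTo (λ j → g j * (X^ a) (n ∸ j)) (suc n)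
      ≈⟨ sumTo-single (λ j → g j * (X^ a) (n ∸ j)) (suc n) (s≤s (ℕ.m∸n≤m n a)) (λ j j≤n j≢n∸a →
           trans (*-cong refl (reflexive (X^-offdiag {a} {n ∸ j} λ a≡n∸j →
             j≢n∸a (≡.trans (≡.sym (ℕ.m∸[m∸n]≡n (ℕ.s≤s⁻¹ j≤n))) (≡.cong (n ∸_) (≡.sym a≡n∸j))))))
           (zeroʳ _)) ⟩
    g (n ∸ a) * (X^ a) (n ∸ (n ∸ a))  ≈⟨ *-cong refl (reflexive (≡.trans (≡.cong (X^ a) (ℕ.m∸[m∸n]≡n a≤n)) (X^-diag a))) ⟩
    g (n ∸ a) * 1#                     ≈⟨ *-identityʳ _ ⟩
    g (n ∸ a)                          ≡⟨ shift-≤ a g a≤n ⟨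
    shift a g n                        ∎
  ... | no  a≰n = trans
    (sumTo-zero (suc n) λ j _ →
      trans (*-cong refl (reflexive (X^-offdiag λ a≡n∸j → a≰n (ℕ.≤-trans (ℕ.≤-reflexive a≡n∸j) (ℕ.m∸n≤m n j)))))
            (zeroʳ _))
    (sym (reflexive (shift-> a g (ℕ.≰⇒> a≰n))))

  -- Below X^(2Q), (X + u)^m = X^m + m·X^(m−1)·u when u = O(X^Q). The coefficient of X^(m−1)·u
  -- at X^n is shift m u (suc n), which avoids the truncated subtraction m − 1.
  module FirstOrder {h u : PS} {Q : ℕ} .{{_ : ℕ.NonZero Q}}
                    (h≈X+u : ∀ j → h j ≈ (X^ 1) j + u j) (u<Q≈0 : ∀ j → j ℕ.< Q → u j ≈ 0#) where

    natE*shift-below : ∀ m {a} → a ℕ.< Q → natE m * shift m u (suc a) ≈ 0#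
    natE*shift-below zero    _   = zeroˡ _
    natE*shift-below (suc m) a<Q =
      trans (*-cong refl (shift-vanishes u u<Q≈0 m _ (ℕ.≤-<-trans (ℕ.m∸n≤m _ m) a<Q))) (zeroʳ _)

    powₛ-coeff : ∀ m {n} → n ℕ.< Q ℕ.+ Q → powₛ h m n ≈ (X^ m) n + natE m * shift m u (suc n)
    powₛ-coeff zero {n} _ = begin
      oneₛ n                                  ≡⟨ oneₛ≡X^0 n ⟩
      (X^ 0) n                                ≈⟨ +-identityʳ _ ⟨
      (X^ 0) n + 0#                           ≈⟨ +-cong refl (zeroˡ _) ⟨
      (X^ 0) n + 0# * shift 0 u (suc n)       ∎
      where
      oneₛ≡X^0 : ∀ n → oneₛ n ≡ (X^ 0) n
      oneₛ≡X^0 zero    = ≡.refl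
      oneₛ≡X^0 (suc n) = ≡.refl
    powₛ-coeff (suc m) {n} n<2Q = begin
      (h *ₛ B) n
        ≈⟨ sumTo-cong (suc n) (λ j _ → trans (*-cong (h≈X+u j) refl) (distribʳ _ _ _)) ⟩
      sumTo (λ j → (X^ 1) j * B (n ∸ j) + u j * B (n ∸ j)) (suc n)
        ≈⟨ sumTo-+ _ _ (suc n) ⟩
      ((X^ 1) *ₛ B) n + (u *ₛ B) n
        ≈⟨ +-cong (X^*ₛ-coeff 1 B n) (trans (sumTo-cong (suc n) B≈X^m) (*ₛX^-coeff m u n)) ⟩
      shift 1 B n + shift m u n
        ≈⟨ collect n n<2Q ⟩
      (X^ suc m) n + natE (suc m) * shift (suc m) u (suc n) ∎
      where
      B : PS
      B = powₛ h m
      B≈X^m : ∀ j → j ℕ.< suc n → u j * B (n ∸ j) ≈ u j * (X^ m) (n ∸ j)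
      B≈X^m j _ with Q ℕ.≤? j
      ... | no  j≱Q = trans (*-cong (u<Q≈0 j (ℕ.≰⇒> j≱Q)) refl)
                            (trans (zeroˡ _) (sym (trans (*-cong (u<Q≈0 j (ℕ.≰⇒> j≱Q)) refl) (zeroˡ _))))
      ... | yes Q≤j = *-cong refl (trans (powₛ-coeff m (ℕ.<-trans n∸j<Q (ℕ.m<m+n Q (ℕ.>-nonZero⁻¹ Q))))
                                         (trans (+-cong refl (natE*shift-below m n∸j<Q)) (+-identityʳ _)))
        where
        n∸j<Q : n ∸ j ℕ.< Q
        n∸j<Q = ℕ.m<n+o⇒m∸n<o n j (ℕ.<-≤-trans n<2Q (ℕ.+-monoˡ-≤ Q Q≤j))
      collect : ∀ n → n ℕ.< Q ℕ.+ Q →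
                shift 1 B n + shift m u n ≈ (X^ suc m) n + natE (suc m) * shift (suc m) u (suc n)
      collect zero    _       = +-cong refl (trans s₀≈0 (sym (trans (*-cong refl s₀≈0) (zeroʳ _))))
        where
        s₀≈0 : shift m u 0 ≈ 0#
        s₀≈0 = shift-vanishes u u<Q≈0 m 0 (ℕ.≤-<-trans (ℕ.≤-reflexive (ℕ.0∸n≡0 m)) (ℕ.>-nonZero⁻¹ Q))
      collect (suc n) 1+n<2Q = begin
        B n + shift m u (suc n)
          ≈⟨ +-cong (powₛ-coeff m (ℕ.<-trans (ℕ.n<1+n n) 1+n<2Q)) refl ⟩
        ((X^ m) n + natE m * s) + s   ≈⟨ +-assoc _ _ _ ⟩
        (X^ m) n + (natE m * s + s)   ≈⟨ +-cong refl (+-comm _ _) ⟩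
        (X^ m) n + (s + natE m * s)   ≈⟨ +-cong refl (+-cong (*-identityˡ s) refl) ⟨
        (X^ m) n + (1# * s + natE m * s) ≈⟨ +-cong refl (distribʳ s 1# (natE m)) ⟨
        (X^ m) n + (1# + natE m) * s  ∎
        where
        s : Carrier
        s = shift m u (suc n)

    compₛ-coeff : ∀ (f : PS) {N} → N ℕ.< Q ℕ.+ Q →
                  compₛ f h N ≈ f N + sumTo (λ m → f m * (natE m * shift m u (suc N))) (suc N)
    compₛ-coeff f {N} N<2Q = begin
      sumTo (λ m → f m * powₛ h m N) (suc N)
        ≈⟨ sumTo-cong (suc N) (λ m _ → trans (*-cong refl (powₛ-coeff m N<2Q)) (distribˡ _ _ _)) ⟩
      sumTo (λ m → f m * (X^ m) N + f m * (natE m * shift m u (suc N))) (suc N)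
        ≈⟨ sumTo-+ _ _ (suc N) ⟩
      sumTo (λ m → f m * (X^ m) N) (suc N) + sumTo (λ m → f m * (natE m * shift m u (suc N))) (suc N)
        ≈⟨ +-cong (sumTo-*X^ f (ℕ.n<1+n N)) refl ⟩
      f N + sumTo (λ m → f m * (natE m * shift m u (suc N))) (suc N) ∎

  first-order-coeff-at-Q+n :
    ∀ {Q} .{{_ : ℕ.NonZero Q}} (f u : PS) {n} → (∀ j → j ℕ.< Q → u j ≈ 0#) → u Q ≈ 1# →
    (∀ m → m ℕ.< suc n → f m * natE m ≈ 0#) →
    sumTo (λ m → f m * (natE m * shift m u (suc (Q ℕ.+ n)))) (suc (Q ℕ.+ n)) ≈ f (suc n) * natE (suc n)
  first-order-coeff-at-Q+n {Q} f u {n} u<Q≈0 uQ≈1 f′≈0 = begin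
    sumTo term (suc (Q ℕ.+ n))
      ≈⟨ sumTo-single term (suc (Q ℕ.+ n)) (s≤s (ℕ.+-monoˡ-≤ n (ℕ.>-nonZero⁻¹ Q))) others ⟩
    f (suc n) * (natE (suc n) * shift n u (Q ℕ.+ n))
      ≡⟨ ≡.cong (λ t → f (suc n) * (natE (suc n) * t))
           (≡.trans (shift-≤ n u (ℕ.m≤n+m n Q)) (≡.cong u (ℕ.m+n∸n≡m Q n))) ⟩
    f (suc n) * (natE (suc n) * u Q)  ≈⟨ *-cong refl (trans (*-cong refl uQ≈1) (*-identityʳ _)) ⟩
    f (suc n) * natE (suc n)          ∎
    where
    term : PS
    term m = f m * (natE m * shift m u (suc (Q ℕ.+ n)))
    others : ∀ m → m ℕ.< suc (Q ℕ.+ n) → m ≢ suc n → term m ≈ 0#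
    others m _ m≢1+n with ℕ.<-cmp m (suc n)
    ... | tri< m<1+n _ _ = trans (sym (*-assoc _ _ _)) (trans (*-cong (f′≈0 m m<1+n) refl) (zeroˡ _))
    ... | tri≈ _ m≡1+n _ = contradiction m≡1+n m≢1+n
    others zero    _ _ | tri> _ _ ()
    others (suc m) _ _ | tri> _ _ (s≤s n<m) =
      trans (*-cong refl (trans (*-cong refl shift≈0) (zeroʳ _))) (zeroʳ _)
      where
      shift≈0 : shift m u (Q ℕ.+ n) ≈ 0#
      shift≈0 = shift-vanishes u u<Q≈0 m (Q ℕ.+ n)
                  (ℕ.m<n+o⇒m∸n<o (Q ℕ.+ n) m (≡.subst (Q ℕ.+ n ℕ.<_) (ℕ.+-comm Q m) (ℕ.+-monoʳ-< Q n<m)))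

module CharacteristicP {c ℓ} (R : CommutativeRing c ℓ) {p : ℕ} (p-prime : Prime p) (char-p : HasChar R p) where

  open CommutativeRing R
  open PowerSeries R
  open Series R
  open PrimePowerBinomial
  open import Data.Nat as ℕ using (zero; suc; z≤n; s≤s; z<s; _^_)
  open import Data.Nat.Primality using (prime⇒nonZero; prime⇒nonTrivial)
  import Data.Nat.Properties as ℕ
  open import Data.Nat.Combinatorics using (_C_; nCn≡1; k>n⇒nCk≡0; nCk+nC[k+1]≡[n+1]C[k+1])
  open import Data.Nat.Divisibility using (_∣_; divides)
  open import Data.Nat.Coprimality using (coprime-Bézout)
  open import Data.Nat.GCD using (module Bézout)
  open import Relation.Nullary using (¬_; yes; no)
  open import Relation.Binary.Definitions using (tri<; tri≈; tri>)
  open import Relation.Binary.PropositionalEquality as ≡ using (_≡_)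
  open import Relation.Binary.Reasoning.Setoid setoid
  open import Algebra.Properties.AbelianGroup +-abelianGroup using (xyx⁻¹≈y)
  open import Data.Rational as ℚ using (1ℚ)
  open import Data.Product using (∃; _,_)
  open NatToRational using (q*[m*n]≡m*q*n; ℕ→ℚ[T+n]<q*T+μ-eventually)
  open import Data.Nat.Induction using (<-rec)

  natE-multiple : ∀ m {n} → natE n ≈ 0# → natE (m ℕ.* n) ≈ 0#
  natE-multiple m {n} n≈0 = trans (natE-* m n) (trans (*-cong refl n≈0) (zeroʳ _))

  natE-∣ : ∀ {n} → p ∣ n → natE n ≈ 0#
  natE-∣ (divides m ≡.refl) = natE-multiple m char-p

  natE-∤ : ¬ (1# ≈ 0#) → ∀ {n} → ¬ p ∣ n → ¬ natE n ≈ 0#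
  natE-∤ 1≉0 {n} p∤n n≈0 = 1≉0 (from-Bézout (coprime-Bézout (∤⇒coprime p-prime p∤n)))
    where
    1≈0 : ∀ {a b} → suc a ≡ b → natE a ≈ 0# → natE b ≈ 0# → 1# ≈ 0#
    1≈0 {a} ≡.refl a≈0 1+a≈0 = begin
      1#            ≈⟨ +-identityʳ 1# ⟨
      1# + 0#       ≈⟨ +-cong refl a≈0 ⟨
      1# + natE a   ≈⟨ 1+a≈0 ⟩
      0#            ∎
    from-Bézout : Bézout.Identity 1 p n → 1# ≈ 0#
    from-Bézout (Bézout.+- x y eq) = 1≈0 eq (natE-multiple y n≈0) (natE-multiple x char-p)
    from-Bézout (Bézout.-+ x y eq) = 1≈0 eq (natE-multiple x char-p) (natE-multiple y n≈0)

  private instance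
    p≢0 : ℕ.NonZero p
    p≢0 = prime⇒nonZero p-prime

  1<p : 1 ℕ.< p
  1<p = ℕ.nonTrivial⇒n>1 p {{prime⇒nonTrivial p-prime}}

  natE-[p^M]C : ∀ M j → natE ((p ^ M) C j) ≈ (X^ 0) j + (X^ (p ^ M)) j
  natE-[p^M]C M zero = begin
    natE 1             ≈⟨ natE-1 ⟩
    1#                 ≈⟨ +-identityʳ 1# ⟨
    1# + 0#            ≡⟨ ≡.cong (1# +_) (X^-offdiag (ℕ.>⇒≢ (ℕ.m^n>0 p M))) ⟨
    1# + (X^ (p ^ M)) 0 ∎
  natE-[p^M]C M (suc j) with ℕ.<-cmp (suc j) (p ^ M)
  ... | tri< j<Q _ _ = trans (natE-∣ (p∣[p^M]Cj p-prime M (suc j) z<s j<Q))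
                             (sym (trans (+-identityˡ _) (reflexive (X^-offdiag (ℕ.>⇒≢ j<Q)))))
  ... | tri≈ _ j≡Q _ = begin
    natE ((p ^ M) C suc j)   ≡⟨ ≡.cong (λ t → natE ((p ^ M) C t)) j≡Q ⟩
    natE ((p ^ M) C p ^ M)   ≡⟨ ≡.cong natE (nCn≡1 (p ^ M)) ⟩
    natE 1                   ≈⟨ natE-1 ⟩
    1#                       ≈⟨ +-identityˡ 1# ⟨
    0# + 1#                  ≡⟨ ≡.cong (0# +_) (≡.trans (≡.cong (X^ (p ^ M)) j≡Q) (X^-diag (p ^ M))) ⟨
    0# + (X^ (p ^ M)) (suc j) ∎
  ... | tri> _ _ Q<j = begin
    natE ((p ^ M) C suc j)   ≡⟨ ≡.cong natE (k>n⇒nCk≡0 Q<j) ⟩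
    0#                       ≈⟨ +-identityʳ 0# ⟨
    0# + 0#                  ≡⟨ ≡.cong (0# +_) (X^-offdiag (ℕ.<⇒≢ Q<j)) ⟨
    0# + (X^ (p ^ M)) (suc j) ∎

  natE-[1+p^M]C : ∀ M j → natE (suc (p ^ M) C suc j) ≈ (X^ 1) (suc j) + ((X^ (p ^ M)) (suc j) + (X^ suc (p ^ M)) (suc j))
  natE-[1+p^M]C M j = begin
    natE (suc Q C suc j)                  ≡⟨ ≡.cong natE (nCk+nC[k+1]≡[n+1]C[k+1] Q j) ⟨
    natE (Q C j ℕ.+ Q C suc j)            ≈⟨ natE-+ (Q C j) (Q C suc j) ⟩
    natE (Q C j) + natE (Q C suc j)       ≈⟨ +-cong (natE-[p^M]C M j) (natE-[p^M]C M (suc j)) ⟩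
    (x + y) + (0# + z)                    ≈⟨ +-cong refl (+-identityˡ z) ⟩
    (x + y) + z                           ≈⟨ +-assoc x y z ⟩
    x + (y + z)                           ≈⟨ +-cong refl (+-comm y z) ⟩
    x + (z + y)                           ∎
    where
    Q : ℕ
    Q = p ^ M
    x y z : Carrier
    x = (X^ 0) j
    y = (X^ Q) j
    z = (X^ Q) (suc j)

  module TestPointSeries {k : ℕ} (1≤k : 1 ℕ.≤ k) (i : ℕ) where

    open Digits.TestPoint p 1≤k 1<p i public

    Q : ℕ
    Q = p ^ M

    instance
      Q≢0 : ℕ.NonZero Q
      Q≢0 = ℕ.m^n≢0 p M

    M<Q : M ℕ.< Q
    M<Q = n<m^n 1<p M

    u : PS
    u j = (X^ Q) j + (X^ suc Q) j

    u<Q≈0 : ∀ j → j ℕ.< Q → u j ≈ 0#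
    u<Q≈0 j j<Q = begin
      (X^ Q) j + (X^ suc Q) j ≡⟨ ≡.cong₂ _+_ (X^-offdiag (ℕ.>⇒≢ j<Q)) (X^-offdiag (ℕ.>⇒≢ (ℕ.m<n⇒m<1+n j<Q))) ⟩
      0# + 0#                 ≈⟨ +-identityʳ 0# ⟩
      0#                      ∎

    uQ≈1 : u Q ≈ 1#
    uQ≈1 = begin
      (X^ Q) Q + (X^ suc Q) Q ≡⟨ ≡.cong₂ _+_ (X^-diag Q) (X^-offdiag (ℕ.>⇒≢ (ℕ.n<1+n Q))) ⟩
      1# + 0#                 ≈⟨ +-identityʳ 1# ⟩
      1#                      ∎

    binomMinusOne-p^i : ∀ j → binomMinusOne p d j ≈ (X^ 1) j + u j
    binomMinusOne-p^i zero = sym (trans (+-identityˡ (u 0)) (u<Q≈0 0 (ℕ.>-nonZero⁻¹ Q)))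
    binomMinusOne-p^i (suc n) with M ℕ.≤? suc n
    ... | yes M≤1+n = trans (reflexive (≡.cong (λ t → natE (t C suc n)) (trunc-d-≥ M≤1+n))) (natE-[1+p^M]C M n)
    ... | no  M≰1+n = begin
      natE (trunc p d (suc (suc n)) C suc n) ≡⟨ ≡.cong (λ t → natE (t C suc n)) (trunc-d-≤ (s≤s z≤n) (ℕ.≰⇒> M≰1+n)) ⟩
      natE (1 C suc n)                       ≈⟨ natE-[p^M]C 0 (suc n) ⟩
      0# + (X^ 1) (suc n)                    ≈⟨ +-comm _ _ ⟩
      (X^ 1) (suc n) + 0#                    ≈⟨ +-cong refl (u<Q≈0 (suc n) (ℕ.<-trans (ℕ.≰⇒> M≰1+n) M<Q)) ⟨
      (X^ 1) (suc n) + u (suc n)             ∎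

    binomMinusOne-0ₚ : ∀ j → binomMinusOne p d₀ j ≈ (X^ 1) j + 0#
    binomMinusOne-0ₚ zero    = sym (+-identityʳ 0#)
    binomMinusOne-0ₚ (suc n) = begin
      natE (trunc p d₀ (suc (suc n)) C suc n) ≡⟨ ≡.cong (λ t → natE (t C suc n)) (trunc-d₀ (suc n)) ⟩
      natE (1 C suc n)                        ≈⟨ natE-[p^M]C 0 (suc n) ⟩
      0# + (X^ 1) (suc n)                     ≈⟨ +-comm _ _ ⟩
      (X^ 1) (suc n) + 0#                     ∎

    act-difference : ∀ (f : PS) {n} → n ℕ.< Q → (∀ m → m ℕ.< suc n → f m * natE m ≈ 0#) →
                     act p d f (Q ℕ.+ n) - act p d₀ f (Q ℕ.+ n) ≈ f (suc n) * natE (suc n)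
    act-difference f {n} n<Q f′≈0 = begin
      act p d f N - act p d₀ f N          ≈⟨ +-cong (Xu.compₛ-coeff f N<2Q) (-‿cong (X0.compₛ-coeff f N<2Q)) ⟩
      (f N + S u) - (f N + S (λ _ → 0#))  ≈⟨ +-cong refl (-‿cong (trans (+-cong refl S0≈0) (+-identityʳ (f N)))) ⟩
      (f N + S u) - f N                   ≈⟨ xyx⁻¹≈y (f N) (S u) ⟩
      S u                                 ≈⟨ first-order-coeff-at-Q+n f u u<Q≈0 uQ≈1 f′≈0 ⟩
      f (suc n) * natE (suc n)            ∎
      where
      N : ℕ
      N = Q ℕ.+ n
      N<2Q : N ℕ.< Q ℕ.+ Q
      N<2Q = ℕ.+-monoʳ-< Q n<Q
      S : PS → Carrier
      S v = sumTo (λ m → f m * (natE m * shift m v (suc N))) (suc N)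
      S0≈0 : S (λ _ → 0#) ≈ 0#
      S0≈0 = sumTo-zero (suc N) λ m _ → trans (*-cong refl (trans (*-cong refl
               (shift-vanishes (λ _ → 0#) (λ _ _ → refl) m (suc N) (s≤s (ℕ.m∸n≤m (suc N) m)))) (zeroʳ _))) (zeroʳ _)
      module Xu = FirstOrder binomMinusOne-p^i u<Q≈0
      module X0 = FirstOrder {Q = Q} binomMinusOne-0ₚ (λ _ _ → refl)

  f′≈0⇒InXp : IsField R → ∀ (f : PS) → (∀ m → f m * natE m ≈ 0#) → InXp p f
  f′≈0⇒InXp isField f f′≈0 n p∤n with IsField.inverse isField (natE n) (natE-∤ (IsField.nontrivial isField) p∤n)
  ... | y , ny≈1 = begin
    f n                     ≈⟨ *-identityʳ (f n) ⟨
    f n * 1#                ≈⟨ *-cong refl ny≈1 ⟨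
    f n * (natE n * y)      ≈⟨ *-assoc (f n) (natE n) y ⟨
    (f n * natE n) * y      ≈⟨ *-cong (f′≈0 n) refl ⟩
    0# * y                  ≈⟨ zeroˡ y ⟩
    0#                      ∎

  derivative-step : ∀ {k} → 1 ℕ.≤ k → ∀ {q} → 1ℚ ℚ.< q → ∀ (f : PS) → IsShP p k (ℕ→ℚ (p ^ k) ℚ.* q) f →
                    ∀ n → (∀ m → m ℕ.< suc n → f m * natE m ≈ 0#) → f (suc n) * natE (suc n) ≈ 0#
  derivative-step {k} 1≤k {q} 1<q f (μ , shifted) n f′≈0 =
    at-large-test-point (ℕ→ℚ[T+n]<q*T+μ-eventually 1<q n μ)
    where
    at-large-test-point : (∃ λ T₀ → ∀ T → T₀ ℕ.≤ T → ℕ→ℚ (T ℕ.+ n) ℚ.< q ℚ.* ℕ→ℚ T ℚ.+ μ) →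
                          f (suc n) * natE (suc n) ≈ 0#
    at-large-test-point (T₀ , bound) = begin
      f (suc n) * natE (suc n)                   ≈⟨ act-difference f n<Q f′≈0 ⟨
      act p d f (Q ℕ.+ n) - act p d₀ f (Q ℕ.+ n) ≈⟨ shifted p^i 0ₚ i p^i≡0ₚ-below (Q ℕ.+ n) Q+n<bound ⟩
      0#                                         ∎
      where
      i : ℕ
      i = T₀ ℕ.+ n
      open TestPointSeries 1≤k i
      i<Q : i ℕ.< Q
      i<Q = ℕ.<-≤-trans (n<m^n 1<p i) (ℕ.^-monoʳ-≤ p (ℕ.m≤n+m i k))
      n<Q : n ℕ.< Q
      n<Q = ℕ.≤-<-trans (ℕ.m≤n+m n T₀) i<Q
      Q+n<bound : ℕ→ℚ (Q ℕ.+ n) ℚ.< ℕ→ℚ (p ^ k) ℚ.* q ℚ.* ℕ→ℚ (p ^ i) ℚ.+ μ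
      Q+n<bound = ≡.subst (λ t → ℕ→ℚ (Q ℕ.+ n) ℚ.< t ℚ.+ μ)
                    (≡.trans (≡.cong (λ t → q ℚ.* ℕ→ℚ t) (ℕ.^-distribˡ-+-* p k i))
                             (q*[m*n]≡m*q*n q (p ^ k) (p ^ i)))
                    (bound Q (ℕ.<⇒≤ (ℕ.≤-<-trans (ℕ.m≤m+n T₀ n) i<Q)))

  derivative-vanishes : ∀ {k} → 1 ℕ.≤ k → ∀ {q} → 1ℚ ℚ.< q → ∀ (f : PS) → IsShP p k (ℕ→ℚ (p ^ k) ℚ.* q) f →
                        ∀ m → f m * natE m ≈ 0#
  derivative-vanishes 1≤k 1<q f shifted = <-rec _ λ where
    zero    _        → zeroʳ (f 0)
    (suc n) f′<1+n≈0 → derivative-step 1≤k 1<q f shifted n (λ _ → f′<1+n≈0)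

open import Data.Nat using (_≤_; _^_)
open import Data.Rational using (ℚ; 1ℚ; _<_; _*_)
open import Relation.Binary.PropositionalEquality using (_≡_)

proposition2p4 : ∀ {c ℓ} (p : ℕ) → Prime p →
    (E : CommutativeRing c ℓ) → IsField E → HasChar E p →
    (k : ℕ) → 1 ≤ k → (p ≡ 2 → 2 ≤ k) →
    -- q plays the role of p^ε for ε > 0, i.e. an arbitrary q > 1
    (q : ℚ) → 1ℚ < q →
    (f : PowerSeries.PS E) →
    PowerSeries.IsShP E p k (ℕ→ℚ (p ^ k) * q) f →
    PowerSeries.InXp E p f
proposition2p4 p p-prime E isField char-p k 1≤k _ q 1<q f shifted =
  f′≈0⇒InXp isField f (derivative-vanishes 1≤k 1<q f shifted)
  where open CharacteristicP E p-prime char-p using (f′≈0⇒InXp; derivative-vanishes)
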